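{- Let $(\Psi;\mathcal{E},\cdot,1,0)$ be an atomic information algebra over the join-semilattice $(D;\le)$. Then: 1. if $\alpha$ is an atom, then for all $x\in D$, $\epsilon_x(\alpha)$ is an atom relative to $x$; 2. if $\alpha$ is an atom with support $x$, then it is an atom relative to $x$; 3. for all $x\in D$ and every atom $\alpha'$ relative to $x$ there is an atom $\alpha$ with $\alpha'=\epsilon_x(\alpha)$; 4. if $x\le y$ and $\alpha$ is an atom relative to $x$, then there is an atom $\beta$ relative to $y$ with $\alpha=\epsilon_x(\beta)$; 5. if $x\le y$, $\alpha$ is an atom relative to $x$, and $\psi\in\Psi$ has support $y$ with $\alpha\ge\epsilon_x(\psi)$, then there is an atom $\beta$ relative to $y$ with $\beta\ge\psi$ and $\epsilon_x(\beta)=\alpha$.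
   Context: An information algebra $(\Psi;\mathcal{E},\cdot,1,0)$ consists of a set $\Psi$ with an associative, commutative, idempotent binary operation $\cdot$ with unit $1$ and null $0$, a join-semilattice $(D;\le)$ and maps $\epsilon_x:\Psi\to\Psi$ ($x\in D$) with, for all $x,y,\phi,\psi$: (E1) $\epsilon_x(0)=0$; (E2) $\psi\cdot\epsilon_x(\psi)=\psi$; (E3) $\epsilon_x(\epsilon_x(\phi)\cdot\psi)=\epsilon_x(\phi)\cdot\epsilon_x(\psi)$; (E4) some $x$ has $\epsilon_x(\psi)=\psi$; (E5) $\epsilon_x(\psi)=\psi$ and $x\le y$ imply $\epsilon_y(\psi)=\psi$. $x$ is a support of $\psi$ if $\epsilon_x(\psi)=\psi$. Information order: $\phi\le\psi$ iff $\phi\cdot\psi=\psi$ ($0$ greatest). An atom is $\alpha\ne0$ such that $\alpha\le\psi$ implies $\psi=\alpha$ or $\psi=0$; $At(\psi)=\{\alpha\text{ atom}:\psi\le\alpha\}$. The algebra is atomic if $At(\psi)\ne\emptyset$ for every $\psi\ne0$. An element $\alpha$ is an atom relative to $x$ if $\alpha=\epsilon_x(\alpha)\ne0$ and whenever $\psi=\epsilon_x(\psi)\ge\alpha$ then $\psi=\alpha$ or $\psi=0$. -}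

module Defs where

open import Level using (Level; _⊔_; suc)
open import Data.Product using (Σ; ∃; _×_; _,_)
open import Data.Sum using (_⊎_)
open import Relation.Nullary using (¬_)
open import Relation.Binary.PropositionalEquality using (_≡_; _≢_)
open import Relation.Binary.Lattice.Bundles using (JoinSemilattice)

record InformationAlgebra (a d ℓ₁ ℓ₂ : Level) : Set (suc (a ⊔ d ⊔ ℓ₁ ⊔ ℓ₂)) where
  field
    D   : JoinSemilattice d ℓ₁ ℓ₂
  open JoinSemilattice D public using () renaming (Carrier to Dom; _≤_ to _⊑_)
  infixl 7 _·_
  field
    Ψ   : Set a
    _·_ : Ψ → Ψ → Ψ
    𝟙   : Ψ
    𝟘   : Ψ
    ·-assoc : ∀ φ ψ χ → (φ · ψ) · χ ≡ φ · (ψ · χ)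
    ·-comm  : ∀ φ ψ → φ · ψ ≡ ψ · φ
    ·-idem  : ∀ φ → φ · φ ≡ φ
    ·-unit  : ∀ φ → 𝟙 · φ ≡ φ
    ·-null  : ∀ φ → 𝟘 · φ ≡ 𝟘
    ε   : Dom → Ψ → Ψ
    E1  : ∀ x → ε x 𝟘 ≡ 𝟘
    E2  : ∀ x ψ → ψ · ε x ψ ≡ ψ
    E3  : ∀ x φ ψ → ε x (ε x φ · ψ) ≡ ε x φ · ε x ψ
    E4  : ∀ ψ → ∃ λ x → ε x ψ ≡ ψ
    E5  : ∀ x y ψ → ε x ψ ≡ ψ → x ⊑ y → ε y ψ ≡ ψ

  IsSupport : Dom → Ψ → Set a
  IsSupport x ψ = ε x ψ ≡ ψ

  _≤ᵢ_ : Ψ → Ψ → Set a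
  φ ≤ᵢ ψ = φ · ψ ≡ ψ

  IsAtom : Ψ → Set a
  IsAtom α = α ≢ 𝟘 × (∀ ψ → α ≤ᵢ ψ → ψ ≡ α ⊎ ψ ≡ 𝟘)

  _∈At_ : Ψ → Ψ → Set a
  α ∈At ψ = IsAtom α × ψ ≤ᵢ α

  Atomic : Set a
  Atomic = ∀ ψ → ψ ≢ 𝟘 → ∃ λ α → α ∈At ψ

  IsAtomRelTo : Dom → Ψ → Set a
  IsAtomRelTo x α = ε x α ≡ α × α ≢ 𝟘
    × (∀ ψ → ε x ψ ≡ ψ → α ≤ᵢ ψ → ψ ≡ α ⊎ ψ ≡ 𝟘)

-- Projection ε x never annihilates (ε x ψ = 𝟘 forces ψ = 𝟘) and, against x-supported
-- elements, behaves like a conditional: ε x (φ · ψ) = φ · ε x ψ when x supports φ.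
-- Hence every non-zero x-supported element lying above an atom relative to x is
-- projected back onto it, so projecting an atom γ lying over α yields the required
-- relative atoms.  The atoms γ are supplied by atomicity, applied to α · ψ in part 5,
-- which is non-zero because its x-projection is α; part 4 is the case ψ = α.
module Submission where

open import Defs
open import Level using (Level)
open import Data.Product using (∃; _×_; _,_; proj₁)
open import Data.Sum using (_⊎_; inj₁; inj₂)
open import Data.Empty using (⊥-elim)
open import Relation.Binary.PropositionalEquality
  using (_≡_; _≢_; sym; trans; cong; subst)
open Relation.Binary.PropositionalEquality.≡-Reasoning

module Properties {a d ℓ₁ ℓ₂ : Level} (I : InformationAlgebra a d ℓ₁ ℓ₂) where
  open InformationAlgebra I

  ≤ᵢ-trans : ∀ {φ ψ χ} → φ ≤ᵢ ψ → ψ ≤ᵢ χ → φ ≤ᵢ χ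
  ≤ᵢ-trans {φ} {ψ} {χ} φ≤ψ ψ≤χ = begin
    φ · χ        ≡⟨ cong (φ ·_) (sym ψ≤χ) ⟩
    φ · (ψ · χ)  ≡⟨ sym (·-assoc φ ψ χ) ⟩
    (φ · ψ) · χ  ≡⟨ cong (_· χ) φ≤ψ ⟩
    ψ · χ        ≡⟨ ψ≤χ ⟩
    χ            ∎

  ≤ᵢ-antisym : ∀ {φ ψ} → φ ≤ᵢ ψ → ψ ≤ᵢ φ → φ ≡ ψ
  ≤ᵢ-antisym {φ} {ψ} φ≤ψ ψ≤φ = trans (sym ψ≤φ) (trans (·-comm ψ φ) φ≤ψ)

  x≤ᵢx·y : ∀ φ ψ → φ ≤ᵢ (φ · ψ)
  x≤ᵢx·y φ ψ = trans (sym (·-assoc φ φ ψ)) (cong (_· ψ) (·-idem φ))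

  y≤ᵢx·y : ∀ φ ψ → ψ ≤ᵢ (φ · ψ)
  y≤ᵢx·y φ ψ = subst (ψ ≤ᵢ_) (·-comm ψ φ) (x≤ᵢx·y ψ φ)

  ε-≤ᵢ : ∀ x ψ → ε x ψ ≤ᵢ ψ
  ε-≤ᵢ x ψ = trans (·-comm (ε x ψ) ψ) (E2 x ψ)

  ε-·-support : ∀ x {φ} ψ → IsSupport x φ → ε x (φ · ψ) ≡ φ · ε x ψ
  ε-·-support x {φ} ψ sφ = begin
    ε x (φ · ψ)      ≡⟨ cong (λ χ → ε x (χ · ψ)) (sym sφ) ⟩
    ε x (ε x φ · ψ)  ≡⟨ E3 x φ ψ ⟩
    ε x φ · ε x ψ    ≡⟨ cong (_· ε x ψ) sφ ⟩
    φ · ε x ψ        ∎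

  ε-idem : ∀ x ψ → ε x (ε x ψ) ≡ ε x ψ
  ε-idem x ψ = begin
    ε x (ε x ψ)          ≡⟨ cong (ε x) (sym (·-idem (ε x ψ))) ⟩
    ε x (ε x ψ · ε x ψ)  ≡⟨ E3 x ψ (ε x ψ) ⟩
    ε x ψ · ε x (ε x ψ)  ≡⟨ E2 x (ε x ψ) ⟩
    ε x ψ                ∎

  ε-mono : ∀ x {φ ψ} → φ ≤ᵢ ψ → ε x φ ≤ᵢ ε x ψ
  ε-mono x {φ} {ψ} φ≤ψ = sym (begin
    ε x ψ            ≡⟨ cong (ε x) (sym (≤ᵢ-trans (ε-≤ᵢ x φ) φ≤ψ)) ⟩
    ε x (ε x φ · ψ)  ≡⟨ E3 x φ ψ ⟩
    ε x φ · ε x ψ    ∎)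

  ε≡𝟘⇒≡𝟘 : ∀ x {ψ} → ε x ψ ≡ 𝟘 → ψ ≡ 𝟘
  ε≡𝟘⇒≡𝟘 x {ψ} εψ≡𝟘 = begin
    ψ          ≡⟨ sym (E2 x ψ) ⟩
    ψ · ε x ψ  ≡⟨ cong (ψ ·_) εψ≡𝟘 ⟩
    ψ · 𝟘      ≡⟨ ·-comm ψ 𝟘 ⟩
    𝟘 · ψ      ≡⟨ ·-null ψ ⟩
    𝟘          ∎

  support-≤ᵢ-ε : ∀ x {φ ψ} → IsSupport x φ → φ ≤ᵢ ψ → φ ≤ᵢ ε x ψ
  support-≤ᵢ-ε x {φ} {ψ} sφ φ≤ψ = subst (_≤ᵢ ε x ψ) sφ (ε-mono x φ≤ψ)

  ε-atom-isAtomRelTo : ∀ α → IsAtom α → ∀ x → IsAtomRelTo x (ε x α)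
  ε-atom-isAtomRelTo α (α≢𝟘 , α-atom) x =
    ε-idem x α , (λ εα≡𝟘 → α≢𝟘 (ε≡𝟘⇒≡𝟘 x εα≡𝟘)) , maximal
    where
    maximal : ∀ ψ → IsSupport x ψ → ε x α ≤ᵢ ψ → ψ ≡ ε x α ⊎ ψ ≡ 𝟘
    maximal ψ sψ εα≤ψ with α-atom (α · ψ) (x≤ᵢx·y α ψ)
    ... | inj₁ α·ψ≡α =
      inj₁ (≤ᵢ-antisym (support-≤ᵢ-ε x sψ (subst (ψ ≤ᵢ_) α·ψ≡α (y≤ᵢx·y α ψ))) εα≤ψ)
    ... | inj₂ α·ψ≡𝟘 = inj₂ (begin
      ψ            ≡⟨ sym εα≤ψ ⟩
      ε x α · ψ    ≡⟨ ·-comm (ε x α) ψ ⟩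
      ψ · ε x α    ≡⟨ sym (ε-·-support x α sψ) ⟩
      ε x (ψ · α)  ≡⟨ cong (ε x) (trans (·-comm ψ α) α·ψ≡𝟘) ⟩
      ε x 𝟘        ≡⟨ E1 x ⟩
      𝟘            ∎)

  atom-isAtomRelTo-support : ∀ α x → IsAtom α → IsSupport x α → IsAtomRelTo x α
  atom-isAtomRelTo-support α x α-atom sα =
    subst (IsAtomRelTo x) sα (ε-atom-isAtomRelTo α α-atom x)

  isAtomRelTo-ε-above : ∀ x {α γ} → IsAtomRelTo x α → γ ≢ 𝟘 → α ≤ᵢ γ → ε x γ ≡ α
  isAtomRelTo-ε-above x {α} {γ} (sα , _ , maximal) γ≢𝟘 α≤γ
    with maximal (ε x γ) (ε-idem x γ) (support-≤ᵢ-ε x sα α≤γ)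
  ... | inj₁ εγ≡α = εγ≡α
  ... | inj₂ εγ≡𝟘 = ⊥-elim (γ≢𝟘 (ε≡𝟘⇒≡𝟘 x εγ≡𝟘))

  isAtomRelTo-lift : Atomic → ∀ x α′ → IsAtomRelTo x α′ →
                     ∃ λ α → IsAtom α × α′ ≡ ε x α
  isAtomRelTo-lift atomic x α′ rel@(_ , α′≢𝟘 , _) with atomic α′ α′≢𝟘
  ... | α , α-atom , α′≤α =
    α , α-atom , sym (isAtomRelTo-ε-above x rel (proj₁ α-atom) α′≤α)

  ε-atom-above-isAtomRelTo : ∀ {x y α γ} → x ⊑ y → IsAtomRelTo x α →
                             IsAtom γ → α ≤ᵢ γ →
                             IsAtomRelTo y (ε y γ) × ε x (ε y γ) ≡ α
  ε-atom-above-isAtomRelTo {x} {y} {α} {γ} x⊑y rel@(sα , _ , _) γ-atom α≤γ =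
    ε-atom-isAtomRelTo γ γ-atom y , ≤ᵢ-antisym below above
    where
    below : ε x (ε y γ) ≤ᵢ α
    below = subst (ε x (ε y γ) ≤ᵢ_) (isAtomRelTo-ε-above x rel (proj₁ γ-atom) α≤γ)
                  (ε-mono x (ε-≤ᵢ y γ))
    above : α ≤ᵢ ε x (ε y γ)
    above = support-≤ᵢ-ε x sα (support-≤ᵢ-ε y (E5 x y α sα x⊑y) α≤γ)

  isAtomRelTo-extend : Atomic → ∀ x y α ψ → x ⊑ y → IsAtomRelTo x α →
                       IsSupport y ψ → ε x ψ ≤ᵢ α →
                       ∃ λ β → IsAtomRelTo y β × ψ ≤ᵢ β × ε x β ≡ α
  isAtomRelTo-extend atomic x y α ψ x⊑y rel@(sα , α≢𝟘 , _) sψ εψ≤α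
    with atomic (α · ψ) α·ψ≢𝟘
    where
    ε-α·ψ : ε x (α · ψ) ≡ α
    ε-α·ψ = trans (ε-·-support x ψ sα) (trans (·-comm α (ε x ψ)) εψ≤α)
    α·ψ≢𝟘 : α · ψ ≢ 𝟘
    α·ψ≢𝟘 α·ψ≡𝟘 = α≢𝟘 (trans (sym ε-α·ψ) (trans (cong (ε x) α·ψ≡𝟘) (E1 x)))
  ... | γ , γ-atom , α·ψ≤γ
    with ε-atom-above-isAtomRelTo x⊑y rel γ-atom (≤ᵢ-trans (x≤ᵢx·y α ψ) α·ψ≤γ)
  ... | relγ , εεγ≡α =
    ε y γ , relγ , support-≤ᵢ-ε y sψ (≤ᵢ-trans (y≤ᵢx·y α ψ) α·ψ≤γ) , εεγ≡α

  isAtomRelTo-refine : Atomic → ∀ x y α → x ⊑ y → IsAtomRelTo x α →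
                       ∃ λ β → IsAtomRelTo y β × α ≡ ε x β
  isAtomRelTo-refine atomic x y α x⊑y rel@(sα , _ , _)
    with isAtomRelTo-extend atomic x y α α x⊑y rel (E5 x y α sα x⊑y)
                            (subst (_≤ᵢ α) (sym sα) (·-idem α))
  ... | β , relβ , _ , εβ≡α = β , relβ , sym εβ≡α

mainTheorem20 : ∀ {a d ℓ₁ ℓ₂ : Level} (I : InformationAlgebra a d ℓ₁ ℓ₂) →
    let open InformationAlgebra I in
    Atomic →
    (∀ α → IsAtom α → ∀ x → IsAtomRelTo x (ε x α))
    × (∀ α x → IsAtom α → IsSupport x α → IsAtomRelTo x α)
    × (∀ x α′ → IsAtomRelTo x α′ → ∃ λ α → IsAtom α × α′ ≡ ε x α)
    × (∀ x y α → x ⊑ y → IsAtomRelTo x α →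
         ∃ λ β → IsAtomRelTo y β × α ≡ ε x β)
    × (∀ x y α ψ → x ⊑ y → IsAtomRelTo x α → IsSupport y ψ → ε x ψ ≤ᵢ α →
         ∃ λ β → IsAtomRelTo y β × ψ ≤ᵢ β × ε x β ≡ α)
mainTheorem20 I atomic =
  ε-atom-isAtomRelTo , atom-isAtomRelTo-support , isAtomRelTo-lift atomic ,
  isAtomRelTo-refine atomic , isAtomRelTo-extend atomic
  where open Properties I
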